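{- Up to equivalence: (1) $\mathbf{GS1p}$ is the only complete standard system having both contraction $(\mathsf C)$ and weakening $(\mathsf W)$ among its rules; (2) $\mathbf{Pp}$ is the only complete standard system not having weakening $(\mathsf W)$ among its rules; (3) $\mathbf{Np}$ is the only complete standard system not having contraction $(\mathsf C)$ among its rules. In each case, the named system is itself a complete standard system of the stated kind, and every complete standard system of that kind is equivalent to it.
   Context: Formulas are built from literals, namely propositional variables $P$ and their complements $\bar P$, using $\wedge$ and $\vee$. Negation satisfies $\neg P=\bar P$ and $\neg\bar P=P$, and is extended by De Morgan's laws. A sequent is a nonempty finite multiset of formulas. A comma denotes multiset union, and $\Gamma,\Delta,\Sigma$ denote possibly empty multisets. A formula is valid if it evaluates to $1$ under every $0/1$-assignment. Rules: - Axiom: infer $P,\neg P$ from no premises. - $(\&)$: from $\Gamma,A$ and $\Gamma,B$ infer $\Gamma,A\wedge B$. - $(\otimes)$: from $\Delta,A$ and $\Sigma,B$ infer $\Delta,\Sigma,A\wedge B$. - $(\oplus)$: consists of both $(\oplus_1)$ and $(\oplus_2)$, where $(\oplus_i)$ infers $\Gamma,A_1\vee A_2$ from $\Gamma,A_i$. - $(\mathrm{par})$: from $\Gamma,A,B$ infer $\Gamma,A\vee B$. - $(\mathsf W)$: from $\Gamma$ infer $\Gamma,A$. - $(\mathsf C)$: from $\Gamma,A,A$ infer $\Gamma,A$. A standard system is the axiom together with any subset of $\{(\&),(\otimes),(\oplus),(\mathrm{par}),(\mathsf W),(\mathsf C)\}$. The named systems are: - $\mathbf{GS1p}$ = axiom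 + $(\&),(\oplus),(\mathsf W),(\mathsf C)$; - $\mathbf{Pp}$ = axiom + $(\otimes),(\oplus),(\mathsf C)$; - $\mathbf{Np}$ = axiom + $(\&),(\mathrm{par}),(\mathsf W)$. A rule is derivable in $S$ if, for each of its instances, the conclusion is derivable in $S$ from its premises used as extra leaves. $S$ contains $T$ if every rule of $T$ is derivable in $S$. Two systems are equivalent if each contains the other. A system is complete if every valid formula is derivable. -}

module Defs where

open import Data.Nat using (ℕ)
open import Data.Bool using (Bool; true; false; not; _∧_; _∨_)
open import Data.List using (List; []; _∷_; _++_)
open import Data.List.Membership.Propositional using (_∈_)
open import Data.List.Relation.Binary.Permutation.Propositional using (_↭_)
open import Data.Product using (_×_)
open import Data.Empty using (⊥)
open import Relation.Binary.PropositionalEquality using (_≡_)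
open import Relation.Nullary using (¬_)

-- Formulas: literals (variable P = pos p, complement P̄ = neg p), ⋀, ⋁.
infixr 6 _⋀_
infixr 5 _⋁_
data Formula : Set where
  pos : ℕ → Formula
  neg : ℕ → Formula
  _⋀_ : Formula → Formula → Formula
  _⋁_ : Formula → Formula → Formula

∼ : Formula → Formula
∼ (pos p) = neg p
∼ (neg p) = pos p
∼ (A ⋀ B) = ∼ A ⋁ ∼ B
∼ (A ⋁ B) = ∼ A ⋀ ∼ B

eval : (ℕ → Bool) → Formula → Bool
eval v (pos p) = v p
eval v (neg p) = not (v p)
eval v (A ⋀ B) = eval v A ∧ eval v B
eval v (A ⋁ B) = eval v A ∨ eval v B

Valid : Formula → Set
Valid A = (v : ℕ → Bool) → eval v A ≡ true

-- Sequents: finite multisets of formulas, represented as lists up to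
-- permutation (_↭_); derivability is closed under permutation.
Sequent : Set
Sequent = List Formula

data RuleName : Set where
  rAmp rTensor rPlus rPar rW rC : RuleName

-- A standard system: the axiom plus the set of rules r with S r ≡ true.
System : Set
System = RuleName → Bool

data Deriv (S : System) (Hyp : Sequent → Set) : Sequent → Set where
  leaf   : ∀ {Γ} → Hyp Γ → Deriv S Hyp Γ
  perm   : ∀ {Γ Δ} → Γ ↭ Δ → Deriv S Hyp Γ → Deriv S Hyp Δ
  axiom  : ∀ p → Deriv S Hyp (pos p ∷ ∼ (pos p) ∷ [])
  amp    : ∀ {Γ A B} → S rAmp ≡ true →
           Deriv S Hyp (A ∷ Γ) → Deriv S Hyp (B ∷ Γ) → Deriv S Hyp ((A ⋀ B) ∷ Γ)
  tensor : ∀ {Δ Σ A B} → S rTensor ≡ true →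
           Deriv S Hyp (A ∷ Δ) → Deriv S Hyp (B ∷ Σ) → Deriv S Hyp ((A ⋀ B) ∷ Δ ++ Σ)
  plus₁  : ∀ {Γ A B} → S rPlus ≡ true → Deriv S Hyp (A ∷ Γ) → Deriv S Hyp ((A ⋁ B) ∷ Γ)
  plus₂  : ∀ {Γ A B} → S rPlus ≡ true → Deriv S Hyp (B ∷ Γ) → Deriv S Hyp ((A ⋁ B) ∷ Γ)
  par    : ∀ {Γ A B} → S rPar ≡ true → Deriv S Hyp (A ∷ B ∷ Γ) → Deriv S Hyp ((A ⋁ B) ∷ Γ)
  weak   : ∀ {Γ A} → S rW ≡ true → ¬ (Γ ≡ []) → Deriv S Hyp Γ → Deriv S Hyp (A ∷ Γ)
  contr  : ∀ {Γ A} → S rC ≡ true → Deriv S Hyp (A ∷ A ∷ Γ) → Deriv S Hyp (A ∷ Γ)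

data Instance : RuleName → List Sequent → Sequent → Set where
  iAmp    : ∀ Γ A B → Instance rAmp ((A ∷ Γ) ∷ (B ∷ Γ) ∷ []) ((A ⋀ B) ∷ Γ)
  iTensor : ∀ Δ Σ A B → Instance rTensor ((A ∷ Δ) ∷ (B ∷ Σ) ∷ []) ((A ⋀ B) ∷ Δ ++ Σ)
  iPlus₁  : ∀ Γ A B → Instance rPlus ((A ∷ Γ) ∷ []) ((A ⋁ B) ∷ Γ)
  iPlus₂  : ∀ Γ A B → Instance rPlus ((B ∷ Γ) ∷ []) ((A ⋁ B) ∷ Γ)
  iPar    : ∀ Γ A B → Instance rPar ((A ∷ B ∷ Γ) ∷ []) ((A ⋁ B) ∷ Γ)
  iW      : ∀ Γ A → ¬ (Γ ≡ []) → Instance rW (Γ ∷ []) (A ∷ Γ)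
  iC      : ∀ Γ A → Instance rC ((A ∷ A ∷ Γ) ∷ []) (A ∷ Γ)

RuleDerivable : System → RuleName → Set
RuleDerivable S r = ∀ {ps c} → Instance r ps c → Deriv S (λ Γ → Γ ∈ ps) c

-- S contains T (the axiom is common to all standard systems).
Contains : System → System → Set
Contains S T = ∀ r → T r ≡ true → RuleDerivable S r

Equivalent : System → System → Set
Equivalent S T = Contains S T × Contains T S

Complete : System → Set
Complete S = ∀ A → Valid A → Deriv S (λ _ → ⊥) (A ∷ [])

GS1p : System
GS1p rAmp = true
GS1p rTensor = false
GS1p rPlus = true
GS1p rPar = false
GS1p rW = true
GS1p rC = true

Pp : System
Pp rAmp = false
Pp rTensor = true
Pp rPlus = true
Pp rPar = false
Pp rW = false
Pp rC = true

Np : System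
Np rAmp = true
Np rTensor = false
Np rPlus = false
Np rPar = true
Np rW = true
Np rC = false

module Submission where

-- Completeness of Np and Pp is backward proof search. The ⋀ and ⋁ rules are
-- invertible for validity, so a valid sequent decomposes into sequents of
-- literals, each containing a complementary pair. In Np the surplus literals
-- are weakened away. Pp has no weakening, so the search instead carries a
-- derivable sequent whose formulas all occur in the current one, contraction
-- keeping at most one copy of the principal formula; at the root this yields
-- the formula itself.
--
-- Incompleteness of the other systems is shown by finite countermodels: a
-- commutative monoid in which a sequent denotes the product of its formulas,
-- with a set of good elements containing the axioms, closed under the rules of
-- the system, but missing some valid formula. Then the classification follows
-- from & being derivable from ⊗ and C, ⊗ from & and W, ⅋ from ⊕ and C, and ⊕
-- from ⅋ and W.

open import Defs
open import Algebra.Core using (Op₂)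
open import Algebra.Definitions using (Associative; LeftIdentity; Commutative)
open import Algebra.Structures using (IsCommutativeMonoid)
open import Algebra.Consequences.Propositional using (comm∧idˡ⇒idʳ)
open import Data.Bool using (Bool; true; false; T)
open import Data.Bool.Properties using (T-≡; T-∧; T-∨)
open import Data.Empty using (⊥; ⊥-elim)
open import Data.Fin using (Fin; zero; suc; toℕ) renaming (_≟_ to _≟ᶠ_)
open import Data.Fin.Properties using (∀-cons-⇔)
open import Data.List using ([]; _∷_; _++_; [_]; replicate; foldr; map)
open import Data.List.Properties using (++-conicalʳ; ++-identityʳ)
open import Data.List.Membership.Propositional using (_∈_; find)
open import Data.List.Membership.Propositional.Properties using (∈-∃++; ∈-++⁺ʳ; ∈-++⁻)
open import Data.List.Relation.Unary.All as All using (All; []; _∷_)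
open import Data.List.Relation.Unary.Any using (Any; here; there)
open import Data.List.Relation.Binary.Permutation.Propositional
  using (_↭_; ↭-refl; ↭-prep; ↭-swap; ↭-trans; ↭-sym; ↭⇒↭ₛ)
open import Data.List.Relation.Binary.Permutation.Propositional.Properties
  using (shift; ++-comm; ∈-resp-↭; Any-resp-↭; ↭-empty-inv; map⁺)
import Data.List.Relation.Binary.Permutation.Setoid.Properties as PermutationProperties
open import Data.List.Relation.Binary.Subset.Propositional using (_⊆_)
open import Data.List.Relation.Binary.Subset.Propositional.Properties
  using (xs⊆x∷xs; ∷⁺ʳ; ∈-∷⁺ʳ; ⊆-refl; ⊆-reflexive-↭; ⊆[]⇒≡[])
open import Data.Nat as ℕ using (ℕ; zero; suc; NonZero; nonZero; _⊓_; _⊔_)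
open import Data.Nat.DivMod using (_mod_)
open import Data.Nat.Properties using (⊓-comm; ⊔-comm)
open import Data.Product using (_×_; _,_; proj₁; proj₂; ∃-syntax; ∃₂)
open import Data.Sum using (_⊎_; inj₁; inj₂; [_,_]′)
open import Function using (_∘_; Equivalence)
open import Relation.Binary.Definitions using (DecidableEquality)
open import Relation.Binary.PropositionalEquality
  using (_≡_; _≢_; refl; sym; trans; cong; subst; setoid)
open import Relation.Binary.PropositionalEquality.Algebra using (isMagma)
open import Relation.Nullary using (¬_; Dec; does; yes; no; contradiction)
open import Relation.Nullary.Decidable
  using (True; False; toWitness; toWitnessFalse; map′; _×-dec_; _→-dec_; _⊎-dec_; T?)
import Relation.Nullary.Decidable as Dec

Derivable : System → Sequent → Set
Derivable S = Deriv S (λ _ → ⊥)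

∈⇒↭ : ∀ {A : Formula} {Γ} → A ∈ Γ → ∃[ Δ ] Γ ↭ A ∷ Δ
∈⇒↭ A∈Γ with Δ₁ , Δ₂ , refl ← ∈-∃++ A∈Γ = Δ₁ ++ Δ₂ , shift _ Δ₁ Δ₂

module _ {S : System} {H : Sequent → Set} where

  weaken-++ : S rW ≡ true → ∀ Σ {Γ} → Γ ≢ [] → Deriv S H Γ → Deriv S H (Σ ++ Γ)
  weaken-++ w []      Γ≢[] d = d
  weaken-++ w (_ ∷ Σ) Γ≢[] d = weak w (Γ≢[] ∘ ++-conicalʳ Σ _) (weaken-++ w Σ Γ≢[] d)

  absorb : S rC ≡ true → ∀ {A Γ} → A ∈ Γ → Deriv S H (A ∷ Γ) → Deriv S H Γ
  absorb c A∈Γ d with Δ , Γ↭ ← ∈⇒↭ A∈Γ =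
    perm (↭-sym Γ↭) (contr c (perm (↭-prep _ Γ↭) d))

  contract-⊆ : S rC ≡ true → ∀ Γ {Δ} → Γ ⊆ Δ → Deriv S H (Γ ++ Δ) → Deriv S H Δ
  contract-⊆ c []      Γ⊆Δ d = d
  contract-⊆ c (A ∷ Γ) Γ⊆Δ d =
    contract-⊆ c Γ (Γ⊆Δ ∘ there) (absorb c (∈-++⁺ʳ Γ (Γ⊆Δ (here refl))) d)

  contract-replicate : S rC ≡ true → ∀ k {A Γ} →
                       Deriv S H (A ∷ replicate k A ++ Γ) → Deriv S H (A ∷ Γ)
  contract-replicate c zero    d = d
  contract-replicate c (suc k) d = contract-replicate c k (contr c d)

  amp-by-tensor : S rTensor ≡ true → S rC ≡ true → ∀ {Γ A B} →
                  Deriv S H (A ∷ Γ) → Deriv S H (B ∷ Γ) → Deriv S H ((A ⋀ B) ∷ Γ)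
  amp-by-tensor t c {Γ} d e =
    contract-⊆ c Γ there (perm (↭-sym (shift _ Γ Γ)) (tensor t d e))

  tensor-by-amp : S rAmp ≡ true → S rW ≡ true → ∀ {Δ Σ A B} →
                  Deriv S H (A ∷ Δ) → Deriv S H (B ∷ Σ) → Deriv S H ((A ⋀ B) ∷ Δ ++ Σ)
  tensor-by-amp a w {Δ} {Σ} d e =
    amp a (perm (↭-trans (shift _ Σ Δ) (↭-prep _ (++-comm Σ Δ))) (weaken-++ w Σ (λ ()) d))
          (perm (shift _ Δ Σ) (weaken-++ w Δ (λ ()) e))

  par-by-plus : S rPlus ≡ true → S rC ≡ true → ∀ {Γ A B} →
                Deriv S H (A ∷ B ∷ Γ) → Deriv S H ((A ⋁ B) ∷ Γ)
  par-by-plus p c d = contr c (plus₂ p (perm (↭-swap _ _ ↭-refl) (plus₁ p d)))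

  plus₁-by-par : S rPar ≡ true → S rW ≡ true → ∀ {Γ A B} →
                 Deriv S H (A ∷ Γ) → Deriv S H ((A ⋁ B) ∷ Γ)
  plus₁-by-par r w d = par r (perm (↭-swap _ _ ↭-refl) (weak w (λ ()) d))

  plus₂-by-par : S rPar ≡ true → S rW ≡ true → ∀ {Γ A B} →
                 Deriv S H (B ∷ Γ) → Deriv S H ((A ⋁ B) ∷ Γ)
  plus₂-by-par r w d = par r (weak w (λ ()) d)

  graft : ∀ {K Γ} → Deriv S K Γ → (∀ {Δ} → K Δ → Deriv S H Δ) → Deriv S H Γ
  graft (leaf k)       f = f k
  graft (perm p d)     f = perm p (graft d f)
  graft (axiom p)      f = axiom p
  graft (amp s d e)    f = amp s (graft d f) (graft e f)
  graft (tensor s d e) f = tensor s (graft d f) (graft e f)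
  graft (plus₁ s d)    f = plus₁ s (graft d f)
  graft (plus₂ s d)    f = plus₂ s (graft d f)
  graft (par s d)      f = par s (graft d f)
  graft (weak s ne d)  f = weak s ne (graft d f)
  graft (contr s d)    f = contr s (graft d f)

  apply : ∀ {r ps c} → RuleDerivable S r → Instance r ps c → All (Deriv S H) ps → Deriv S H c
  apply rule i ds = graft (rule i) (All.lookup ds)

module _ {S : System} where

  private
    premise₁ : ∀ {Γ ps} → Deriv S (_∈ Γ ∷ ps) Γ
    premise₁ = leaf (here refl)
    premise₂ : ∀ {Γ Δ ps} → Deriv S (_∈ Γ ∷ Δ ∷ ps) Δ
    premise₂ = leaf (there (here refl))

  rule-derivable : ∀ r → S r ≡ true → RuleDerivable S r
  rule-derivable rAmp    s (iAmp _ _ _)      = amp s premise₁ premise₂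
  rule-derivable rTensor s (iTensor _ _ _ _) = tensor s premise₁ premise₂
  rule-derivable rPlus   s (iPlus₁ _ _ _)    = plus₁ s premise₁
  rule-derivable rPlus   s (iPlus₂ _ _ _)    = plus₂ s premise₁
  rule-derivable rPar    s (iPar _ _ _)      = par s premise₁
  rule-derivable rW      s (iW _ _ Γ≢[])     = weak s Γ≢[] premise₁
  rule-derivable rC      s (iC _ _)          = contr s premise₁

  amp-derivable : S rTensor ≡ true → S rC ≡ true → RuleDerivable S rAmp
  amp-derivable t c (iAmp _ _ _) = amp-by-tensor t c premise₁ premise₂

  tensor-derivable : S rAmp ≡ true → S rW ≡ true → RuleDerivable S rTensor
  tensor-derivable a w (iTensor _ _ _ _) = tensor-by-amp a w premise₁ premise₂

  plus-derivable : S rPar ≡ true → S rW ≡ true → RuleDerivable S rPlus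
  plus-derivable r w (iPlus₁ _ _ _) = plus₁-by-par r w premise₁
  plus-derivable r w (iPlus₂ _ _ _) = plus₂-by-par r w premise₁

  par-derivable : S rPlus ≡ true → S rC ≡ true → RuleDerivable S rPar
  par-derivable p c (iPar _ _ _) = par-by-plus p c premise₁

embed : ∀ {S T H Γ} → Contains S T → Deriv T H Γ → Deriv S H Γ
embed S⊇T (leaf h)       = leaf h
embed S⊇T (perm p d)     = perm p (embed S⊇T d)
embed S⊇T (axiom p)      = axiom p
embed S⊇T (amp s d e)    = apply (S⊇T rAmp s) (iAmp _ _ _) (embed S⊇T d ∷ embed S⊇T e ∷ [])
embed S⊇T (tensor s d e) =
  apply (S⊇T rTensor s) (iTensor _ _ _ _) (embed S⊇T d ∷ embed S⊇T e ∷ [])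
embed S⊇T (plus₁ s d)    = apply (S⊇T rPlus s) (iPlus₁ _ _ _) (embed S⊇T d ∷ [])
embed S⊇T (plus₂ s d)    = apply (S⊇T rPlus s) (iPlus₂ _ _ _) (embed S⊇T d ∷ [])
embed S⊇T (par s d)      = apply (S⊇T rPar s) (iPar _ _ _) (embed S⊇T d ∷ [])
embed S⊇T (weak s ne d)  = apply (S⊇T rW s) (iW _ _ ne) (embed S⊇T d ∷ [])
embed S⊇T (contr s d)    = apply (S⊇T rC s) (iC _ _) (embed S⊇T d ∷ [])

complete-⊇ : ∀ {S T} → Contains S T → Complete T → Complete S
complete-⊇ S⊇T complete A valid = embed S⊇T (complete A valid)

excluded : ∀ {b} {X : Set} → b ≡ false → b ≡ true → X
excluded off on = contradiction (trans (sym on) off) λ ()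

GS1p-⊇ : ∀ S → Contains GS1p S
GS1p-⊇ _ rAmp    _ = rule-derivable rAmp refl
GS1p-⊇ _ rTensor _ = tensor-derivable refl refl
GS1p-⊇ _ rPlus   _ = rule-derivable rPlus refl
GS1p-⊇ _ rPar    _ = par-derivable refl refl
GS1p-⊇ _ rW      _ = rule-derivable rW refl
GS1p-⊇ _ rC      _ = rule-derivable rC refl

Pp-⊇ : ∀ {S} → S rW ≡ false → Contains Pp S
Pp-⊇ _ rAmp    _ = amp-derivable refl refl
Pp-⊇ _ rTensor _ = rule-derivable rTensor refl
Pp-⊇ _ rPlus   _ = rule-derivable rPlus refl
Pp-⊇ _ rPar    _ = par-derivable refl refl
Pp-⊇ w rW        = excluded w
Pp-⊇ _ rC      _ = rule-derivable rC refl

Np-⊇ : ∀ {S} → S rC ≡ false → Contains Np S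
Np-⊇ _ rAmp    _ = rule-derivable rAmp refl
Np-⊇ _ rTensor _ = tensor-derivable refl refl
Np-⊇ _ rPlus   _ = plus-derivable refl refl
Np-⊇ _ rPar    _ = rule-derivable rPar refl
Np-⊇ _ rW      _ = rule-derivable rW refl
Np-⊇ c rC        = excluded c

_≟_ : DecidableEquality Formula
pos p ≟ pos q = map′ (cong pos) (λ { refl → refl }) (p ℕ.≟ q)
neg p ≟ neg q = map′ (cong neg) (λ { refl → refl }) (p ℕ.≟ q)
(A ⋀ B) ≟ (C ⋀ D) =
  map′ (λ { (refl , refl) → refl }) (λ { refl → refl , refl }) (A ≟ C ×-dec B ≟ D)
(A ⋁ B) ≟ (C ⋁ D) =
  map′ (λ { (refl , refl) → refl }) (λ { refl → refl , refl }) (A ≟ C ×-dec B ≟ D)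
pos _   ≟ neg _   = no λ ()
pos _   ≟ (_ ⋀ _) = no λ ()
pos _   ≟ (_ ⋁ _) = no λ ()
neg _   ≟ pos _   = no λ ()
neg _   ≟ (_ ⋀ _) = no λ ()
neg _   ≟ (_ ⋁ _) = no λ ()
(_ ⋀ _) ≟ pos _   = no λ ()
(_ ⋀ _) ≟ neg _   = no λ ()
(_ ⋀ _) ≟ (_ ⋁ _) = no λ ()
(_ ⋁ _) ≟ pos _   = no λ ()
(_ ⋁ _) ≟ neg _   = no λ ()
(_ ⋁ _) ≟ (_ ⋀ _) = no λ ()

open import Data.List.Membership.DecPropositional _≟_ using (_∈?_)

⊨_ : Sequent → Set
⊨ Γ = ∀ v → Any (T ∘ eval v) Γ

valid⇒⊨ : ∀ {A} → Valid A → ⊨ [ A ]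
valid⇒⊨ valid v = here (Equivalence.from T-≡ (valid v))

⊨-↭ : ∀ {Γ Δ} → Γ ↭ Δ → ⊨ Γ → ⊨ Δ
⊨-↭ p ⊨Γ v = Any-resp-↭ p (⊨Γ v)

⊨-⋀ˡ : ∀ {A B Γ} → ⊨ ((A ⋀ B) ∷ Γ) → ⊨ (A ∷ Γ)
⊨-⋀ˡ ⊨Γ v with ⊨Γ v
... | here t  = here (proj₁ (Equivalence.to T-∧ t))
... | there m = there m

⊨-⋀ʳ : ∀ {A B Γ} → ⊨ ((A ⋀ B) ∷ Γ) → ⊨ (B ∷ Γ)
⊨-⋀ʳ ⊨Γ v with ⊨Γ v
... | here t  = here (proj₂ (Equivalence.to T-∧ t))
... | there m = there m

⊨-⋁ : ∀ {A B Γ} → ⊨ ((A ⋁ B) ∷ Γ) → ⊨ (A ∷ B ∷ Γ)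
⊨-⋁ ⊨Γ v with ⊨Γ v
... | here t  = [ here , there ∘ here ]′ (Equivalence.to T-∨ t)
... | there m = there (there m)

data IsLiteral : Formula → Set where
  pos : ∀ p → IsLiteral (pos p)
  neg : ∀ p → IsLiteral (neg p)

complementary-pair : ∀ {Λ} → All IsLiteral Λ → ⊨ Λ → ∃[ p ] pos p ∈ Λ × neg p ∈ Λ
complementary-pair {Λ} literals ⊨Λ = pair (find (⊨Λ v))
  where
  v : ℕ → Bool
  v p = does (neg p ∈? Λ)

  pair : ∃[ A ] A ∈ Λ × T (eval v A) → ∃[ p ] pos p ∈ Λ × neg p ∈ Λ
  pair (pos p , p∈Λ , t) with neg p ∈? Λ
  ... | yes p̄∈Λ = p , p∈Λ , p̄∈Λ
  ... | no _    = ⊥-elim t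
  pair (neg p , p̄∈Λ , t) with neg p ∈? Λ
  ... | yes _   = ⊥-elim t
  ... | no p̄∉Λ = contradiction p̄∈Λ p̄∉Λ
  pair ((_ ⋀ _) , A∈Λ , _) with () ← All.lookup literals A∈Λ
  pair ((_ ⋁ _) , A∈Λ , _) with () ← All.lookup literals A∈Λ

module ⊨-Induction
  (R : Sequent → Set)
  (R-↭ : ∀ {Γ Δ} → Γ ↭ Δ → R Γ → R Δ)
  (R-axiom : ∀ {p Γ} → pos p ∈ Γ → neg p ∈ Γ → R Γ)
  (R-⋀ : ∀ {A B Γ} → R (A ∷ Γ) → R (B ∷ Γ) → R ((A ⋀ B) ∷ Γ))
  (R-⋁ : ∀ {A B Γ} → R (A ∷ B ∷ Γ) → R ((A ⋁ B) ∷ Γ))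
  where

  private
    Reducible : Sequent → Set
    Reducible Γ = ∀ {Λ} → All IsLiteral Λ → ⊨ (Γ ++ Λ) → R (Γ ++ Λ)

    reducible-[] : Reducible []
    reducible-[] literals ⊨Λ with _ , p∈Λ , p̄∈Λ ← complementary-pair literals ⊨Λ =
      R-axiom p∈Λ p̄∈Λ

    reducible-literal : ∀ {A Γ} → IsLiteral A → Reducible Γ → Reducible (A ∷ Γ)
    reducible-literal {Γ = Γ} A-literal ρ {Λ} literals ⊨AΓΛ =
      R-↭ (shift _ Γ Λ) (ρ (A-literal ∷ literals) (⊨-↭ (↭-sym (shift _ Γ Λ)) ⊨AΓΛ))

    reducible-∷ : ∀ A {Γ} → Reducible Γ → Reducible (A ∷ Γ)
    reducible-∷ (pos p) ρ = reducible-literal (pos p) ρ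
    reducible-∷ (neg p) ρ = reducible-literal (neg p) ρ
    reducible-∷ (A ⋀ B) ρ literals ⊨Γ =
      R-⋀ (reducible-∷ A ρ literals (⊨-⋀ˡ ⊨Γ)) (reducible-∷ B ρ literals (⊨-⋀ʳ ⊨Γ))
    reducible-∷ (A ⋁ B) ρ literals ⊨Γ =
      R-⋁ (reducible-∷ A (reducible-∷ B ρ) literals (⊨-⋁ ⊨Γ))

    reducible : ∀ Γ → Reducible Γ
    reducible []      = reducible-[]
    reducible (A ∷ Γ) = reducible-∷ A (reducible Γ)

  ⊨⇒R : ∀ {Γ} → ⊨ Γ → R Γ
  ⊨⇒R {Γ} ⊨Γ =
    subst R (++-identityʳ Γ) (reducible Γ [] (subst ⊨_ (sym (++-identityʳ Γ)) ⊨Γ))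

weakened-axiom : ∀ {S H p Γ} → S rW ≡ true → pos p ∈ Γ → neg p ∈ Γ → Deriv S H Γ
weakened-axiom {p = p} w p∈Γ p̄∈Γ with Δ , Γ↭ ← ∈⇒↭ p∈Γ with ∈-resp-↭ Γ↭ p̄∈Γ
... | there p̄∈Δ with Δ′ , Δ↭ ← ∈⇒↭ p̄∈Δ =
  perm (↭-sym (↭-trans Γ↭ (↭-prep _ Δ↭)))
       (perm (++-comm Δ′ _) (weaken-++ w Δ′ (λ ()) (axiom p)))

Np-complete : Complete Np
Np-complete A valid = ⊨⇒R (valid⇒⊨ valid)
  where open ⊨-Induction (Derivable Np) perm (weakened-axiom refl) (amp refl) (par refl)

GS1p-complete : Complete GS1p
GS1p-complete = complete-⊇ (GS1p-⊇ Np) Np-complete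

derivable-nonempty : ∀ {S Γ} → Derivable S Γ → Γ ≢ []
derivable-nonempty (leaf ())
derivable-nonempty (perm p d) refl = derivable-nonempty d (↭-empty-inv p)
derivable-nonempty (axiom _)      ()
derivable-nonempty (amp _ _ _)    ()
derivable-nonempty (tensor _ _ _) ()
derivable-nonempty (plus₁ _ _)    ()
derivable-nonempty (plus₂ _ _)    ()
derivable-nonempty (par _ _)      ()
derivable-nonempty (weak _ _ _)   ()
derivable-nonempty (contr _ _)    ()

separate : ∀ A Δ {Γ} → Δ ⊆ A ∷ Γ → ∃₂ λ k R → Δ ↭ replicate k A ++ R × R ⊆ Γ
separate A []      _   = 0 , [] , ↭-refl , λ ()
separate A (B ∷ Δ) {Γ} B∷Δ⊆ with B ≟ A | separate A Δ (B∷Δ⊆ ∘ there)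
... | yes refl | k , R , Δ↭ , R⊆Γ = suc k , R , ↭-prep A Δ↭ , R⊆Γ
... | no B≢A   | k , R , Δ↭ , R⊆Γ =
  k , B ∷ R , ↭-trans (↭-prep B Δ↭) (↭-sym (shift B (replicate k A) R)) , ∈-∷⁺ʳ B∈Γ R⊆Γ
  where
  B∈Γ : B ∈ Γ
  B∈Γ with B∷Δ⊆ (here refl)
  ... | here B≡A  = contradiction B≡A B≢A
  ... | there B∈Γ = B∈Γ

Subsumed : Sequent → Set
Subsumed Γ = ∃[ Δ ] Δ ⊆ Γ × Derivable Pp Δ

subsumed-⊆ : ∀ {Γ Γ′} → Γ ⊆ Γ′ → Subsumed Γ → Subsumed Γ′
subsumed-⊆ Γ⊆Γ′ (Δ , Δ⊆Γ , d) = Δ , Γ⊆Γ′ ∘ Δ⊆Γ , d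

subsumed-axiom : ∀ {p Γ} → pos p ∈ Γ → neg p ∈ Γ → Subsumed Γ
subsumed-axiom p∈Γ p̄∈Γ = _ , (λ { (here refl) → p∈Γ ; (there (here refl)) → p̄∈Γ }) , axiom _

focus : ∀ {A Γ Δ} → Δ ⊆ A ∷ Γ → Derivable Pp Δ →
        Subsumed Γ ⊎ ∃[ Δ′ ] Δ′ ⊆ Γ × Derivable Pp (A ∷ Δ′)
focus {A} {Δ = Δ} Δ⊆AΓ d with separate A Δ Δ⊆AΓ
... | zero  , R , Δ↭ , R⊆Γ = inj₁ (R , R⊆Γ , perm Δ↭ d)
... | suc k , R , Δ↭ , R⊆Γ = inj₂ (R , R⊆Γ , contract-replicate refl k (perm Δ↭ d))

subsumed-rule : ∀ {A B Γ} → (∀ {Δ} → Derivable Pp (A ∷ Δ) → Derivable Pp (B ∷ Δ)) →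
                Subsumed (A ∷ Γ) → Subsumed (B ∷ Γ)
subsumed-rule rule (_ , Δ⊆AΓ , d) with focus Δ⊆AΓ d
... | inj₁ s                  = subsumed-⊆ (xs⊆x∷xs _ _) s
... | inj₂ (Δ′ , Δ′⊆Γ , d′) = _ ∷ Δ′ , ∷⁺ʳ _ Δ′⊆Γ , rule d′

subsumed-⋀ : ∀ {A B Γ} → Subsumed (A ∷ Γ) → Subsumed (B ∷ Γ) → Subsumed ((A ⋀ B) ∷ Γ)
subsumed-⋀ (_ , Δ⊆AΓ , d) (_ , Δ⊆BΓ , e) with focus Δ⊆AΓ d | focus Δ⊆BΓ e
... | inj₁ s | _      = subsumed-⊆ (xs⊆x∷xs _ _) s
... | _      | inj₁ s = subsumed-⊆ (xs⊆x∷xs _ _) s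
... | inj₂ (Δ₁ , Δ₁⊆Γ , d′) | inj₂ (Δ₂ , Δ₂⊆Γ , e′) =
  _ ∷ Δ₁ ++ Δ₂ , ∷⁺ʳ _ ([ Δ₁⊆Γ , Δ₂⊆Γ ]′ ∘ ∈-++⁻ Δ₁) , tensor refl d′ e′

subsumed-⋁ : ∀ {A B Γ} → Subsumed (A ∷ B ∷ Γ) → Subsumed ((A ⋁ B) ∷ Γ)
subsumed-⋁ = subsumed-⊆ (∈-∷⁺ʳ (here refl) ⊆-refl) ∘ subsumed-rule (plus₂ refl)
           ∘ subsumed-⊆ (⊆-reflexive-↭ (↭-swap _ _ ↭-refl)) ∘ subsumed-rule (plus₁ refl)

open ⊨-Induction Subsumed (subsumed-⊆ ∘ ⊆-reflexive-↭) subsumed-axiom subsumed-⋀ subsumed-⋁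
  using () renaming (⊨⇒R to ⊨⇒subsumed)

Pp-complete : Complete Pp
Pp-complete A valid with _ , Δ⊆A , d ← ⊨⇒subsumed (valid⇒⊨ valid) with focus Δ⊆A d
... | inj₁ (_ , Δ′⊆[] , d′) = contradiction (⊆[]⇒≡[] Δ′⊆[]) (derivable-nonempty d′)
... | inj₂ (_ , Δ′⊆[] , d′) with refl ← ⊆[]⇒≡[] Δ′⊆[] = d′

record Model : Set₁ where
  field
    Carrier : Set
    _∙_ : Op₂ Carrier
    ε : Carrier
    isCommutativeMonoid : IsCommutativeMonoid _≡_ _∙_ ε
    Good : Carrier → Set
    conj disj : Op₂ Carrier
    atom coatom : ℕ → Carrier
    axiom-good : ∀ p → Good (atom p ∙ (coatom p ∙ ε))

  open IsCommutativeMonoid isCommutativeMonoid using (assoc; identityˡ)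

  ⟦_⟧ : Formula → Carrier
  ⟦ pos p ⟧ = atom p
  ⟦ neg p ⟧ = coatom p
  ⟦ A ⋀ B ⟧ = conj ⟦ A ⟧ ⟦ B ⟧
  ⟦ A ⋁ B ⟧ = disj ⟦ A ⟧ ⟦ B ⟧

  ⟦_⟧ˢ : Sequent → Carrier
  ⟦ Γ ⟧ˢ = foldr _∙_ ε (map ⟦_⟧ Γ)

  ⟦⟧ˢ-↭ : ∀ {Γ Δ} → Γ ↭ Δ → ⟦ Γ ⟧ˢ ≡ ⟦ Δ ⟧ˢ
  ⟦⟧ˢ-↭ p = PermutationProperties.foldr-commMonoid (setoid Carrier) isCommutativeMonoid
              (↭⇒↭ₛ (map⁺ ⟦_⟧ p))

  ⟦⟧ˢ-++ : ∀ Δ Σ → ⟦ Δ ++ Σ ⟧ˢ ≡ ⟦ Δ ⟧ˢ ∙ ⟦ Σ ⟧ˢ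
  ⟦⟧ˢ-++ []      Σ = sym (identityˡ ⟦ Σ ⟧ˢ)
  ⟦⟧ˢ-++ (A ∷ Δ) Σ = trans (cong (⟦ A ⟧ ∙_) (⟦⟧ˢ-++ Δ Σ)) (sym (assoc ⟦ A ⟧ ⟦ Δ ⟧ˢ ⟦ Σ ⟧ˢ))

  RuleSound : RuleName → Set
  RuleSound rAmp    = ∀ g a b → Good (a ∙ g) → Good (b ∙ g) → Good (conj a b ∙ g)
  RuleSound rTensor = ∀ g h a b → Good (a ∙ g) → Good (b ∙ h) → Good (conj a b ∙ (g ∙ h))
  RuleSound rPlus   = ∀ g a b → Good (a ∙ g) ⊎ Good (b ∙ g) → Good (disj a b ∙ g)
  RuleSound rPar    = ∀ g a b → Good (a ∙ (b ∙ g)) → Good (disj a b ∙ g)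
  RuleSound rW      = ∀ g a → Good g → Good (a ∙ g)
  RuleSound rC      = ∀ g a → Good (a ∙ (a ∙ g)) → Good (a ∙ g)

  Validates : System → Set
  Validates S = ∀ r → S r ≡ true → RuleSound r

  sound : ∀ {S Γ} → Validates S → Derivable S Γ → Good ⟦ Γ ⟧ˢ
  sound V (leaf ())
  sound V (perm p d)   = subst Good (⟦⟧ˢ-↭ p) (sound V d)
  sound V (axiom p)    = axiom-good p
  sound V (amp s d e)  = V rAmp s _ _ _ (sound V d) (sound V e)
  sound V (tensor {Δ} {Σ} s d e) =
    subst (λ g → Good (_ ∙ g)) (sym (⟦⟧ˢ-++ Δ Σ)) (V rTensor s _ _ _ _ (sound V d) (sound V e))
  sound V (plus₁ s d)  = V rPlus s _ _ _ (inj₁ (sound V d))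
  sound V (plus₂ s d)  = V rPlus s _ _ _ (inj₂ (sound V d))
  sound V (par s d)    = V rPar s _ _ _ (sound V d)
  sound V (weak s _ d) = V rW s _ _ (sound V d)
  sound V (contr s d)  = V rC s _ _ (sound V d)

  refutes-completeness : ∀ {S A} → Validates S → Valid A → ¬ Good ⟦ [ A ] ⟧ˢ → ¬ Complete S
  refutes-completeness {A = A} V valid bad complete = bad (sound V (complete A valid))

-- Decides the same as Data.Fin.Properties.all?, but several times faster
-- to evaluate; the countermodels below are verified by evaluation.
∀? : ∀ {n} {P : Fin n → Set} → (∀ i → Dec (P i)) → Dec (∀ i → P i)
∀? {zero}  P? = yes λ ()
∀? {suc n} P? = Dec.map ∀-cons-⇔ (P? zero ×-dec ∀? (P? ∘ suc))

record Table : Set where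
  field
    size : ℕ
    {{size-nonZero}} : NonZero size
    mul-table conj-table disj-table : ℕ → ℕ → ℕ
    good-table : ℕ → Bool
    p⁺ p⁻ q⁺ q⁻ : ℕ

  Carrier : Set
  Carrier = Fin size

  -- The product table is read only at (min, max), so it need only be given
  -- for a ≤ b and ∙ is commutative by construction. All table entries are
  -- below size, so _mod size only changes their type.
  _∙_ conj disj : Op₂ Carrier
  a ∙ b    = mul-table (toℕ a ⊓ toℕ b) (toℕ a ⊔ toℕ b) mod size
  conj a b = conj-table (toℕ a) (toℕ b) mod size
  disj a b = disj-table (toℕ a) (toℕ b) mod size

  ε : Carrier
  ε = 0 mod size

  Good : Carrier → Set
  Good a = T (good-table (toℕ a))

  Good? : ∀ a → Dec (Good a)
  Good? a = T? (good-table (toℕ a))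

  atom coatom : ℕ → Carrier
  atom 1 = q⁺ mod size
  atom _ = p⁺ mod size
  coatom 1 = q⁻ mod size
  coatom _ = p⁻ mod size

  ∙-comm : Commutative _≡_ _∙_
  ∙-comm a b rewrite ⊓-comm (toℕ a) (toℕ b) | ⊔-comm (toℕ a) (toℕ b) = refl

  assoc? : Dec (Associative _≡_ _∙_)
  assoc? = ∀? λ a → ∀? λ b → ∀? λ c → (a ∙ b) ∙ c ≟ᶠ a ∙ (b ∙ c)

  identityˡ? : Dec (LeftIdentity _≡_ ε _∙_)
  identityˡ? = ∀? λ a → ε ∙ a ≟ᶠ a

  axiom-good? : Dec (Good (atom 0 ∙ (coatom 0 ∙ ε)) × Good (atom 1 ∙ (coatom 1 ∙ ε)))
  axiom-good? = Good? _ ×-dec Good? _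

  module _ {assoc-ok : True assoc?} {identity-ok : True identityˡ?} {axiom-ok : True axiom-good?} where

    model : Model
    model = record
      { Carrier             = Carrier
      ; _∙_                 = _∙_
      ; ε                   = ε
      ; isCommutativeMonoid = record
        { isMonoid = record
          { isSemigroup = record { isMagma = isMagma _∙_ ; assoc = toWitness assoc-ok }
          ; identity    = identityˡ , comm∧idˡ⇒idʳ ∙-comm identityˡ
          }
        ; comm     = ∙-comm
        }
      ; Good       = Good
      ; conj       = conj
      ; disj       = disj
      ; atom       = atom
      ; coatom     = coatom
      ; axiom-good = axiom-good
      }
      where
      identityˡ : LeftIdentity _≡_ ε _∙_
      identityˡ = toWitness identity-ok
      axiom-good : ∀ p → Good (atom p ∙ (coatom p ∙ ε))
      axiom-good 1             = proj₂ (toWitness axiom-ok)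
      axiom-good 0             = proj₁ (toWitness axiom-ok)
      axiom-good (suc (suc _)) = proj₁ (toWitness axiom-ok)

    open Model model using (RuleSound; Validates; ⟦_⟧ˢ; refutes-completeness)

    ruleSound? : ∀ r → Dec (RuleSound r)
    ruleSound? rAmp    = ∀? λ g → ∀? λ a → ∀? λ b →
      Good? (a ∙ g) →-dec Good? (b ∙ g) →-dec Good? (conj a b ∙ g)
    ruleSound? rTensor = ∀? λ g → ∀? λ h → ∀? λ a → ∀? λ b →
      Good? (a ∙ g) →-dec Good? (b ∙ h) →-dec Good? (conj a b ∙ (g ∙ h))
    ruleSound? rPlus   = ∀? λ g → ∀? λ a → ∀? λ b →
      (Good? (a ∙ g) ⊎-dec Good? (b ∙ g)) →-dec Good? (disj a b ∙ g)
    ruleSound? rPar    = ∀? λ g → ∀? λ a → ∀? λ b →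
      Good? (a ∙ (b ∙ g)) →-dec Good? (disj a b ∙ g)
    ruleSound? rW      = ∀? λ g → ∀? λ a → Good? g →-dec Good? (a ∙ g)
    ruleSound? rC      = ∀? λ g → ∀? λ a → Good? (a ∙ (a ∙ g)) →-dec Good? (a ∙ g)

    ruleSound : ∀ r → {True (ruleSound? r)} → RuleSound r
    ruleSound r {ok} = toWitness ok

    incomplete : ∀ {S} → Validates S → ∀ A → Valid A →
                 {False (Good? ⟦ [ A ] ⟧ˢ)} → ¬ Complete S
    incomplete V A valid {bad} = refutes-completeness {A = A} V valid (toWitnessFalse bad)

P P̄ Q Q̄ : Formula
P = pos 0
P̄ = neg 0
Q = pos 1
Q̄ = neg 1

table₁ : Table
table₁ = record
  { size = 3 ; mul-table = λ { 0 b → b ; 1 1 → 0 ; _ _ → 2 }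
  ; conj-table = λ _ _ → 0 ; disj-table = λ _ _ → 2 ; good-table = λ { 2 → true ; _ → false }
  ; p⁺ = 0 ; p⁻ = 2 ; q⁺ = 0 ; q⁻ = 2 }

incomplete-without-amp-tensor : ∀ {S} → S rAmp ≡ false → S rTensor ≡ false → ¬ Complete S
incomplete-without-amp-tensor {S} a t = incomplete validates ((P ⋁ P̄) ⋀ (P ⋁ P̄)) valid
  where
  open Table table₁
  validates : Model.Validates model S
  validates rAmp      = excluded a
  validates rTensor   = excluded t
  validates rPlus   _ = ruleSound rPlus
  validates rPar    _ = ruleSound rPar
  validates rW      _ = ruleSound rW
  validates rC      _ = ruleSound rC
  valid : Valid ((P ⋁ P̄) ⋀ (P ⋁ P̄))
  valid v with v 0
  ... | true  = refl
  ... | false = refl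

table₂ : Table
table₂ = record
  { size = 3 ; mul-table = λ { 0 b → b ; 1 1 → 0 ; _ _ → 2 }
  ; conj-table = λ _ _ → 2 ; disj-table = λ _ _ → 0 ; good-table = λ { 2 → true ; _ → false }
  ; p⁺ = 0 ; p⁻ = 2 ; q⁺ = 0 ; q⁻ = 2 }

excluded-middle-valid : Valid (P ⋁ P̄)
excluded-middle-valid v with v 0
... | true  = refl
... | false = refl

incomplete-without-plus-par : ∀ {S} → S rPlus ≡ false → S rPar ≡ false → ¬ Complete S
incomplete-without-plus-par {S} p r = incomplete validates (P ⋁ P̄) excluded-middle-valid
  where
  open Table table₂
  validates : Model.Validates model S
  validates rAmp    _ = ruleSound rAmp
  validates rTensor _ = ruleSound rTensor
  validates rPlus     = excluded p
  validates rPar      = excluded r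
  validates rW      _ = ruleSound rW
  validates rC      _ = ruleSound rC

-- Elements 3, 4, 5, 6 interpret P̄, P, Q̄, Q, element 7 interprets the refuted
-- formula, and 14 is an absorbing good element.
table₃ : Table
table₃ = record
  { size = 15
  ; mul-table = λ { 0 b → b
                  ; 1 4 → 9 ; 1 6 → 10 ; 1 12 → 7 ; 2 4 → 7 ; 2 6 → 7 ; 3 4 → 11 ; 3 6 → 10 ; 3 12 → 7
                  ; 4 5 → 9 ; 4 6 → 12 ; 4 8 → 7 ; 4 10 → 7 ; 4 13 → 7 ; 5 6 → 13 ; 5 12 → 7
                  ; 6 9 → 7 ; 6 11 → 7 ; _ _ → 14 }
  ; conj-table = λ { 3 2 → 1 ; 3 5 → 2 ; _ _ → 14 } ; disj-table = λ { 4 8 → 7 ; 6 1 → 8 ; _ _ → 14 }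
  ; good-table = λ { 0 → true ; 11 → true ; 13 → true ; 14 → true ; _ → false }
  ; p⁺ = 4 ; p⁻ = 3 ; q⁺ = 6 ; q⁻ = 5 }

incomplete-without-W-C : ∀ {S} → S rW ≡ false → S rC ≡ false → ¬ Complete S
incomplete-without-W-C {S} w c = incomplete validates (P ⋁ (Q ⋁ (P̄ ⋀ (P̄ ⋀ Q̄)))) valid
  where
  open Table table₃
  validates : Model.Validates model S
  validates rAmp    _ = ruleSound rAmp
  validates rTensor _ = ruleSound rTensor
  validates rPlus   _ = ruleSound rPlus
  validates rPar    _ = ruleSound rPar
  validates rW        = excluded w
  validates rC        = excluded c
  valid : Valid (P ⋁ (Q ⋁ (P̄ ⋀ (P̄ ⋀ Q̄))))
  valid v with v 0 | v 1
  ... | true  | _     = refl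
  ... | false | true  = refl
  ... | false | false = refl

table₄ : Table
table₄ = record
  { size = 4 ; mul-table = λ { 0 b → b ; 2 2 → 2 ; 3 3 → 3 ; _ _ → 1 }
  ; conj-table = λ { 2 0 → 3 ; _ _ → 1 } ; disj-table = λ { 3 3 → 3 ; _ _ → 1 }
  ; good-table = λ { 0 → true ; 1 → true ; _ → false }
  ; p⁺ = 2 ; p⁻ = 3 ; q⁺ = 0 ; q⁻ = 0 }

incomplete-without-W-tensor : ∀ {S} → S rW ≡ false → S rTensor ≡ false → ¬ Complete S
incomplete-without-W-tensor {S} w t = incomplete validates ((P ⋀ Q) ⋁ ((P ⋀ Q̄) ⋁ P̄)) valid
  where
  open Table table₄
  validates : Model.Validates model S
  validates rAmp    _ = ruleSound rAmp
  validates rTensor   = excluded t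
  validates rPlus   _ = ruleSound rPlus
  validates rPar    _ = ruleSound rPar
  validates rW        = excluded w
  validates rC      _ = ruleSound rC
  valid : Valid ((P ⋀ Q) ⋁ ((P ⋀ Q̄) ⋁ P̄))
  valid v with v 0 | v 1
  ... | true  | true  = refl
  ... | true  | false = refl
  ... | false | _     = refl

table₅ : Table
table₅ = record
  { size = 3 ; mul-table = λ { 0 b → b ; 2 2 → 2 ; _ _ → 1 }
  ; conj-table = λ _ _ → 1 ; disj-table = λ { 0 0 → 0 ; 0 2 → 2 ; _ _ → 1 }
  ; good-table = λ { 0 → true ; 1 → true ; _ → false }
  ; p⁺ = 0 ; p⁻ = 0 ; q⁺ = 2 ; q⁻ = 1 }

incomplete-without-W-plus : ∀ {S} → S rW ≡ false → S rPlus ≡ false → ¬ Complete S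
incomplete-without-W-plus {S} w p = incomplete validates ((P ⋁ P̄) ⋁ Q) valid
  where
  open Table table₅
  validates : Model.Validates model S
  validates rAmp    _ = ruleSound rAmp
  validates rTensor _ = ruleSound rTensor
  validates rPlus     = excluded p
  validates rPar    _ = ruleSound rPar
  validates rW        = excluded w
  validates rC      _ = ruleSound rC
  valid : Valid ((P ⋁ P̄) ⋁ Q)
  valid v with v 0
  ... | true  = refl
  ... | false = refl

table₆ : Table
table₆ = record
  { size = 3 ; mul-table = λ { 0 b → b ; _ _ → 1 }
  ; conj-table = λ { 2 2 → 0 ; _ _ → 1 } ; disj-table = λ { 0 2 → 2 ; _ _ → 1 }
  ; good-table = λ { 1 → true ; _ → false }
  ; p⁺ = 2 ; p⁻ = 2 ; q⁺ = 0 ; q⁻ = 1 }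

incomplete-without-C-amp : ∀ {S} → S rC ≡ false → S rAmp ≡ false → ¬ Complete S
incomplete-without-C-amp {S} c a = incomplete validates ((P ⋀ P) ⋁ P̄) valid
  where
  open Table table₆
  validates : Model.Validates model S
  validates rAmp      = excluded a
  validates rTensor _ = ruleSound rTensor
  validates rPlus   _ = ruleSound rPlus
  validates rPar    _ = ruleSound rPar
  validates rW      _ = ruleSound rW
  validates rC        = excluded c
  valid : Valid ((P ⋀ P) ⋁ P̄)
  valid v with v 0
  ... | true  = refl
  ... | false = refl

table₇ : Table
table₇ = record
  { size = 3 ; mul-table = λ { 0 b → b ; _ _ → 1 }
  ; conj-table = λ _ _ → 1 ; disj-table = λ { 2 2 → 2 ; _ _ → 1 }
  ; good-table = λ { 1 → true ; _ → false }
  ; p⁺ = 2 ; p⁻ = 2 ; q⁺ = 0 ; q⁻ = 1 }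

incomplete-without-C-par : ∀ {S} → S rC ≡ false → S rPar ≡ false → ¬ Complete S
incomplete-without-C-par {S} c r = incomplete validates (P ⋁ P̄) excluded-middle-valid
  where
  open Table table₇
  validates : Model.Validates model S
  validates rAmp    _ = ruleSound rAmp
  validates rTensor _ = ruleSound rTensor
  validates rPlus   _ = ruleSound rPlus
  validates rPar      = excluded r
  validates rW      _ = ruleSound rW
  validates rC        = excluded c

has-rule : ∀ {S} r → (S r ≡ false → ¬ Complete S) → Complete S → S r ≡ true
has-rule {S} r incomplete complete with S r
... | true  = refl
... | false = contradiction complete (incomplete refl)

complete⇒⊇GS1p : ∀ {S} → Complete S → S rC ≡ true → S rW ≡ true → Contains S GS1p
complete⇒⊇GS1p {S} complete c w rAmp _ with S rAmp in a
... | true  = rule-derivable rAmp a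
... | false = amp-derivable (has-rule rTensor (incomplete-without-amp-tensor a) complete) c
complete⇒⊇GS1p {S} complete c w rPlus _ with S rPlus in p
... | true  = rule-derivable rPlus p
... | false = plus-derivable (has-rule rPar (incomplete-without-plus-par p) complete) w
complete⇒⊇GS1p complete c w rW _ = rule-derivable rW w
complete⇒⊇GS1p complete c w rC _ = rule-derivable rC c

complete⇒⊇Pp : ∀ {S} → Complete S → S rW ≡ false → Contains S Pp
complete⇒⊇Pp complete w rTensor _ =
  rule-derivable rTensor (has-rule rTensor (incomplete-without-W-tensor w) complete)
complete⇒⊇Pp complete w rPlus _ =
  rule-derivable rPlus (has-rule rPlus (incomplete-without-W-plus w) complete)
complete⇒⊇Pp complete w rC _ =
  rule-derivable rC (has-rule rC (incomplete-without-W-C w) complete)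

complete⇒⊇Np : ∀ {S} → Complete S → S rC ≡ false → Contains S Np
complete⇒⊇Np complete c rAmp _ =
  rule-derivable rAmp (has-rule rAmp (incomplete-without-C-amp c) complete)
complete⇒⊇Np complete c rPar _ =
  rule-derivable rPar (has-rule rPar (incomplete-without-C-par c) complete)
complete⇒⊇Np complete c rW _ =
  rule-derivable rW (has-rule rW (λ w → incomplete-without-W-C w c) complete)

proposition10 :
    ((Complete GS1p × GS1p rC ≡ true × GS1p rW ≡ true)
      × (∀ S → Complete S → S rC ≡ true → S rW ≡ true → Equivalent S GS1p))
    × ((Complete Pp × Pp rW ≡ false)
      × (∀ S → Complete S → S rW ≡ false → Equivalent S Pp))
    × ((Complete Np × Np rC ≡ false)
      × (∀ S → Complete S → S rC ≡ false → Equivalent S Np))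
proposition10 =
    ((GS1p-complete , refl , refl) , λ S complete c w → complete⇒⊇GS1p complete c w , GS1p-⊇ S)
  , ((Pp-complete , refl) , λ S complete w → complete⇒⊇Pp complete w , Pp-⊇ w)
  , ((Np-complete , refl) , λ S complete c → complete⇒⊇Np complete c , Np-⊇ c)
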